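{- For every pair of integers $k\ge 3$ and $l\ge 1$, there exists a graph $G$ with $\chi(G)=k$, $ir(G)=l$ and $\chi_i(G)=k+l-1$.
   Context: All graphs are finite, simple, undirected and connected. Neighborhoods and private neighbors. For a vertex $v$ of a graph $G$, $N[v]$ denotes the closed neighborhood of $v$. For $S\subseteq V(G)$, $N[S]=\bigcup_{v\in S}N[v]$. For $v\in S$, $pn[v,S]=N[v]\setminus N[S\setminus\{v\}]$. Irredundance. A set $S\subseteq V(G)$ is irredundant if $pn[v,S]\neq\emptyset$ for every $v\in S$. It is a maximal irredundant set if $S$ is irredundant and $S\cup\{w\}$ is not irredundant for every $w\in V(G)\setminus S$. The lower irredundance number $ir(G)$ is the minimum cardinality of a maximal irredundant set of $G$. Colorings. $\chi(G)$ is the chromatic number of $G$. An irredundance coloring of $G$ is a proper coloring for which there exists a maximal irredundant set $R$ of $G$ whose vertices all receive pairwise different colors. The irredundance chromatic number $\chi_i(G)$ is the minimum number of colors in an irredundance coloring of $G$. -}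

module Defs where

open import Data.Nat using (ℕ; _≤_)
open import Data.Fin using (Fin)
open import Data.Fin.Subset using (Subset; _∈_; _∉_; _∪_; ⁅_⁆; ∣_∣)
open import Data.Product using (Σ; ∃; _×_; _,_)
open import Data.Sum using (_⊎_)
open import Relation.Nullary using (¬_)
open import Relation.Binary.PropositionalEquality using (_≡_; _≢_)

data Walk {n : ℕ} (Adj : Fin n → Fin n → Set) : Fin n → Fin n → Set where
  here : ∀ {u} → Walk Adj u u
  step : ∀ {u w v} → Adj u w → Walk Adj w v → Walk Adj u v

record Graph : Set₁ where
  field
    n         : ℕ
    Adj       : Fin n → Fin n → Set
    adj?      : ∀ u v → (Adj u v ⊎ ¬ Adj u v)
    sym       : ∀ {u v} → Adj u v → Adj v u
    irrefl    : ∀ {u} → ¬ Adj u u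
    connected : ∀ u v → Walk Adj u v

module _ (G : Graph) where
  open Graph G

  InN : Fin n → Fin n → Set
  InN v w = (v ≡ w) ⊎ Adj v w

  PrivNbr : Subset n → Fin n → Fin n → Set
  PrivNbr S v w = InN v w × (∀ u → u ∈ S → u ≢ v → ¬ InN u w)

  Irredundant : Subset n → Set
  Irredundant S = ∀ v → v ∈ S → ∃ λ w → PrivNbr S v w

  MaximalIrredundant : Subset n → Set
  MaximalIrredundant S = Irredundant S × (∀ w → w ∉ S → ¬ Irredundant (S ∪ ⁅ w ⁆))

  LowerIrredundanceIs : ℕ → Set
  LowerIrredundanceIs l =
    (∃ λ S → MaximalIrredundant S × ∣ S ∣ ≡ l)
    × (∀ S → MaximalIrredundant S → l ≤ ∣ S ∣)

  ProperColoring : (c : ℕ) → (Fin n → Fin c) → Set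
  ProperColoring c col = ∀ u v → Adj u v → col u ≢ col v

  ChromaticNumberIs : ℕ → Set
  ChromaticNumberIs k =
    (Σ (Fin n → Fin k) (ProperColoring k))
    × (∀ c (col : Fin n → Fin c) → ProperColoring c col → k ≤ c)

  IrredundanceColoring : (c : ℕ) → (Fin n → Fin c) → Set
  IrredundanceColoring c col =
    ProperColoring c col
    × (∃ λ R → MaximalIrredundant R
         × (∀ u v → u ∈ R → v ∈ R → col u ≡ col v → u ≡ v))

  IrredundanceChromaticNumberIs : ℕ → Set
  IrredundanceChromaticNumberIs m =
    (Σ (Fin n → Fin m) (IrredundanceColoring m))
    × (∀ c (col : Fin n → Fin c) → IrredundanceColoring c col → m ≤ c)

module Submission where

-- The graph: a clique q₀ … q₍ₐ₋₁₎ with a = k − 1; for each j < l a vertex r j adjacent to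
-- every q i, a pendant vertex p j at r j, and vertices b j i adjacent exactly to q i and r j.
-- The clique together with r₀ gives χ = k. The r j form a maximal irredundant set (each r j has
-- the private neighbour p j, and they dominate), which l fresh colours make rainbow; hence
-- ir ≤ l and χᵢ ≤ a + l. Conversely, in a maximal irredundant set R, if r j ∉ R then p j ∈ R,
-- and if moreover q i ∉ R then b j i ∈ R, because otherwise that vertex could be added to R
-- keeping it irredundant. So R meets every {r j, p j}, giving ir ≥ l; and either R contains
-- every r j, which together with the clique need a + l colours, or R meets all the a + l sets
-- {q i, b j₀ i} and {r j, p j} for some r j₀ ∉ R.

open import Level using (0ℓ)
open import Data.Nat using (ℕ; zero; suc; _+_; _*_; _∸_; _≤_; s≤s)
open import Data.Nat.Properties using (+-identityʳ)
open import Data.Fin using (Fin; zero; suc; _↑ˡ_; _↑ʳ_)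
open import Data.Fin.Properties
  using (+↔⊎; *↔×; injective⇒≤; suc-injective; ↑ˡ-injective; ↑ʳ-injective; all?; ¬∀⟶∃¬)
  renaming (_≟_ to _≟ᶠ_)
open import Data.Fin.Subset using (Subset; inside; outside; _∈_; _∉_; _∪_; ⁅_⁆; ∣_∣)
  renaming (⊤ to ⊤ˢ; ⊥ to ⊥ˢ)
open import Data.Fin.Subset.Properties
  using (_∈?_; ∉⊥; ∣⊥∣≡0; x∈p∪q⁻; x∈p∪q⁺; x∈⁅x⁆; x∈⁅y⁆⇒x≡y)
open import Data.Vec using (_∷_; _++_; here; there)
open import Data.Product using (∃; _×_; _,_; proj₁; proj₂)
open import Data.Sum using (_⊎_; inj₁; inj₂; [_,_]′; fromInj₁; map₂)
open import Data.Sum.Properties using (inj₂-injective)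
open import Data.Sum.Function.Propositional using (_⊎-cong_)
open import Data.Empty using (⊥; ⊥-elim)
open import Function using (_∘_)
open import Function.Bundles using (_↔_; mk↔ₛ′; Inverse; Injection)
open import Function.Definitions using (Injective)
open import Function.Properties.Inverse using (↔-sym; ↔-trans; ↔-refl; ↔⇒↣)
open import Relation.Binary using (Rel; Decidable; DecidableEquality; Symmetric)
open import Relation.Binary.Construct.Closure.ReflexiveTransitive
  using (Star; ε; _◅_; _◅◅_; reverse)
open import Relation.Binary.PropositionalEquality
  using (_≡_; _≢_; refl; sym; trans; cong; subst; subst₂)
open import Relation.Nullary using (¬_; yes; no)
open import Relation.Nullary.Decidable using (map′; decidable-stable; toSum; _⊎-dec_; ¬?)
open import Relation.Unary using (Pred; _⊆_; ∅; ｛_｝)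
  renaming (_∪_ to _∪₁_; Decidable to Decidable₁)

open import Defs hiding (Irredundant; MaximalIrredundant)
import Defs as D

∈-index : ∀ {n} (S : Subset n) {x} → x ∈ S → Fin ∣ S ∣
∈-index (inside ∷ S) here = zero
∈-index (inside ∷ S) (there x∈S) = suc (∈-index S x∈S)
∈-index (outside ∷ S) (there x∈S) = ∈-index S x∈S

∈-index-injective : ∀ {n} (S : Subset n) {x y} (x∈S : x ∈ S) (y∈S : y ∈ S) →
                    ∈-index S x∈S ≡ ∈-index S y∈S → x ≡ y
∈-index-injective (inside ∷ S) here here _ = refl
∈-index-injective (inside ∷ S) (there x∈S) (there y∈S) eq =
  cong suc (∈-index-injective S x∈S y∈S (suc-injective eq))
∈-index-injective (outside ∷ S) (there x∈S) (there y∈S) eq =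
  cong suc (∈-index-injective S x∈S y∈S eq)

injective-into⇒≤∣∣ : ∀ {m n} (S : Subset n) {f : Fin m → Fin n} →
                     Injective _≡_ _≡_ f → (∀ i → f i ∈ S) → m ≤ ∣ S ∣
injective-into⇒≤∣∣ S f-inj f∈S =
  injective⇒≤ (λ eq → f-inj (∈-index-injective S (f∈S _) (f∈S _) eq))

∣⊤ˢ++p∣≡m+∣p∣ : ∀ m {n} (p : Subset n) → ∣ ⊤ˢ {m} ++ p ∣ ≡ m + ∣ p ∣
∣⊤ˢ++p∣≡m+∣p∣ zero p = refl
∣⊤ˢ++p∣≡m+∣p∣ (suc m) p = cong suc (∣⊤ˢ++p∣≡m+∣p∣ m p)

↑ˡ∈⊤ˢ++ : ∀ {m n} (i : Fin m) (p : Subset n) → i ↑ˡ n ∈ ⊤ˢ ++ p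
↑ˡ∈⊤ˢ++ zero p = here
↑ˡ∈⊤ˢ++ (suc i) p = there (↑ˡ∈⊤ˢ++ i p)

↑ʳ∉⊤ˢ++⊥ˢ : ∀ m {n} (j : Fin n) → m ↑ʳ j ∉ ⊤ˢ {m} ++ ⊥ˢ
↑ʳ∉⊤ˢ++⊥ˢ zero j = ∉⊥
↑ʳ∉⊤ˢ++⊥ˢ (suc m) j (there j∈) = ↑ʳ∉⊤ˢ++⊥ˢ m j j∈

↑ˡ≢↑ʳ : ∀ {m n} (i : Fin m) (j : Fin n) → i ↑ˡ n ≢ m ↑ʳ j
↑ˡ≢↑ʳ zero j ()
↑ˡ≢↑ʳ (suc i) j eq = ↑ˡ≢↑ʳ i j (suc-injective eq)

labelled-injective : ∀ {A B V : Set} {P : Pred V 0ℓ} (label : V → A) {g : B → A} →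
                     Injective _≡_ _≡_ g → (rep : ∀ x → ∃ λ v → P v × label v ≡ g x) →
                     Injective _≡_ _≡_ (proj₁ ∘ rep)
labelled-injective label g-inj rep {x} {y} eq =
  g-inj (trans (sym (proj₂ (proj₂ (rep x)))) (trans (cong label eq) (proj₂ (proj₂ (rep y)))))

module Irredundance {V : Set} (_≟_ : DecidableEquality V)
                    (E : Rel V 0ℓ) (E? : Decidable E) where

  N[_] : V → Pred V 0ℓ
  N[ s ] t = s ≡ t ⊎ E s t

  Private : Pred V 0ℓ → V → V → Set
  Private R s t = N[ s ] t × (∀ s′ → R s′ → s′ ≢ s → ¬ N[ s′ ] t)

  Irredundant : Pred V 0ℓ → Set
  Irredundant R = ∀ s → R s → ∃ (Private R s)

  MaximalIrredundant : Pred V 0ℓ → Set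
  MaximalIrredundant R = Irredundant R × (∀ w → ¬ R w → ¬ Irredundant (R ∪₁ ｛ w ｝))

  Dominating : Pred V 0ℓ → Set
  Dominating R = ∀ t → ∃ λ s → R s × N[ s ] t

  private-intro : ∀ {R s t} → N[ s ] t → (∀ s′ → R s′ → N[ s′ ] t → s′ ≡ s) →
                  Private R s t
  private-intro st only = st , λ s′ s′∈R s′≢s s′t → s′≢s (only s′ s′∈R s′t)

  private-unique : ∀ {R s t s′} → Private R s t → R s′ → N[ s′ ] t → s′ ≡ s
  private-unique {s = s} {s′ = s′} (_ , excl) s′∈R s′t =
    decidable-stable (s′ ≟ s) (λ s′≢s → excl s′ s′∈R s′≢s s′t)

  irredundant-⊆ : ∀ {R R′} → R′ ⊆ R → Irredundant R → Irredundant R′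
  irredundant-⊆ R′⊆R irr s s∈R′ with irr s (R′⊆R s∈R′)
  ... | t , st , excl = t , st , λ s′ s′∈R′ → excl s′ (R′⊆R s′∈R′)

  nested⇒redundant : ∀ {R x y} → Irredundant R → R x → R y → y ≢ x →
                     N[ x ] ⊆ N[ y ] → ⊥
  nested⇒redundant irr x∈R y∈R y≢x N[x]⊆N[y] with irr _ x∈R
  ... | t , xt , excl = excl _ y∈R y≢x (N[x]⊆N[y] xt)

  insert-irredundant : ∀ {R w} → Irredundant R →
    (∃ λ t → N[ w ] t × (∀ s → R s → ¬ N[ s ] t)) →
    (∀ {s t} → R s → Private R s t → N[ w ] t → ∃ λ t′ → Private R s t′ × ¬ N[ w ] t′) →
    Irredundant (R ∪₁ ｛ w ｝)
  insert-irredundant {R} {w} irr (tʷ , wtʷ , undominated) reroute = irr′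
    where
    avoiding : ∀ s → R s → ∃ λ t → Private R s t × ¬ N[ w ] t
    avoiding s s∈R with irr s s∈R
    ... | t , priv with (w ≟ t) ⊎-dec E? w t
    ...   | yes wt = reroute s∈R priv wt
    ...   | no ¬wt = t , priv , ¬wt

    irr′ : Irredundant (R ∪₁ ｛ w ｝)
    irr′ s (inj₁ s∈R) with avoiding s s∈R
    ... | t , (st , excl) , ¬wt =
      t , st , λ { s′ (inj₁ s′∈R) → excl s′ s′∈R ; _ (inj₂ refl) _ → ¬wt }
    irr′ _ (inj₂ refl) =
      tʷ , wtʷ , λ { s′ (inj₁ s′∈R) _ → undominated s′ s′∈R
                   ; _ (inj₂ refl) w≢w → ⊥-elim (w≢w refl) }

  irredundant-dominating⇒maximal : ∀ {R} → Irredundant R → Dominating R →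
                                   MaximalIrredundant R
  irredundant-dominating⇒maximal {R} irr dom = irr , no-private
    where
    no-private : ∀ w → ¬ R w → ¬ Irredundant (R ∪₁ ｛ w ｝)
    no-private w w∉R irr′ with irr′ w (inj₂ refl)
    ... | t , _ , excl with dom t
    ...   | s , s∈R , st = excl s (inj₁ s∈R) (λ { refl → w∉R s∈R }) st

  Proper : ∀ {c} → (V → Fin c) → Set
  Proper col = ∀ {s t} → E s t → col s ≢ col t

  RainbowOn : ∀ {c} → Pred V 0ℓ → (V → Fin c) → Set
  RainbowOn R col = ∀ {s t} → R s → R t → col s ≡ col t → s ≡ t

  Apart : Pred V 0ℓ → V → V → Set
  Apart R s t = E s t ⊎ (R s × R t × s ≢ t)

  apart⇒≢ : ∀ {c R s t} {col : V → Fin c} → Proper col → RainbowOn R col →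
            Apart R s t → col s ≢ col t
  apart⇒≢ proper _ (inj₁ e) = proper e
  apart⇒≢ _ rainbow (inj₂ (s∈R , t∈R , s≢t)) = s≢t ∘ rainbow s∈R t∈R

  apart-family⇒≤ : ∀ {A : Set} {m c R} {col : V → Fin c} → Proper col → RainbowOn R col →
                   Fin m ↔ A → (f : A → V) → (∀ x y → x ≡ y ⊎ Apart R (f x) (f y)) → m ≤ c
  apart-family⇒≤ proper rainbow ι f apart = injective⇒≤ λ {x} {y} eq →
    Injection.injective (↔⇒↣ ι)
      (fromInj₁ (λ fx#fy → ⊥-elim (apart⇒≢ proper rainbow fx#fy eq)) (apart (to x) (to y)))
    where open Inverse ι using (to)

  labelled-members⇒≤ : ∀ {A : Set} {m c R} {col : V → Fin c} → RainbowOn R col →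
                       Fin m ↔ A → (label : V → A) →
                       (rep : ∀ x → ∃ λ v → R v × label v ≡ x) → m ≤ c
  labelled-members⇒≤ {R = R} rainbow ι label rep = injective⇒≤ λ {x} {y} eq →
    Injection.injective (↔⇒↣ ι)
      (labelled-injective label (λ eq → eq) rep (rainbow (member (to x)) (member (to y)) eq))
    where
    open Inverse ι using (to)
    member : ∀ x → R (proj₁ (rep x))
    member x = proj₁ (proj₂ (rep x))

module Encoded {V : Set} {n : ℕ} (ι : V ↔ Fin n)
               (E : Rel V 0ℓ) (E? : Decidable E)
               (E-sym : Symmetric E) (E-irrefl : ∀ {v} → ¬ E v v)
               (hub : V) (to-hub : ∀ v → Star E v hub) where

  open Inverse ι using (to; from; strictlyInverseˡ; strictlyInverseʳ)

  to-injective : ∀ {s t} → to s ≡ to t → s ≡ t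
  to-injective = Injection.injective (↔⇒↣ ι)

  from-injective : ∀ {x y} → from x ≡ from y → x ≡ y
  from-injective = Injection.injective (↔⇒↣ (↔-sym ι))

  _≟_ : DecidableEquality V
  s ≟ t = map′ to-injective (cong to) (to s ≟ᶠ to t)

  open Irredundance _≟_ E E? public

  Adj : Fin n → Fin n → Set
  Adj x y = E (from x) (from y)

  adj : ∀ {s t} → E s t → Adj (to s) (to t)
  adj {s} {t} = subst₂ E (sym (strictlyInverseʳ s)) (sym (strictlyInverseʳ t))

  walk : ∀ {s t} → Star E s t → Walk Adj (to s) (to t)
  walk ε = here
  walk (e ◅ es) = step (adj e) (walk es)

  connected : ∀ x y → Walk Adj x y
  connected x y = subst₂ (Walk Adj) (strictlyInverseˡ x) (strictlyInverseˡ y)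
    (walk (to-hub (from x) ◅◅ reverse E-sym (to-hub (from y))))

  G : Graph
  G = record
    { n = n ; Adj = Adj ; adj? = λ x y → toSum (E? (from x) (from y))
    ; sym = E-sym ; irrefl = E-irrefl ; connected = connected }

  Members : Subset n → Pred V 0ℓ
  Members S s = to s ∈ S

  members? : ∀ S → Decidable₁ (Members S)
  members? S s = to s ∈? S

  N⇒InN : ∀ {s t} → N[ s ] t → InN G (to s) (to t)
  N⇒InN (inj₁ refl) = inj₁ refl
  N⇒InN (inj₂ e) = inj₂ (adj e)

  InN⇒N : ∀ {x y} → InN G x y → N[ from x ] (from y)
  InN⇒N (inj₁ refl) = inj₁ refl
  InN⇒N (inj₂ e) = inj₂ e

  private-from : ∀ {S x y} → PrivNbr G S x y → Private (Members S) (from x) (from y)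
  private-from {S} {y = y} (xy , excl) = InN⇒N xy , λ s′ s′∈S s′≢ s′y →
    excl (to s′) s′∈S (λ eq → s′≢ (trans (sym (strictlyInverseʳ s′)) (cong from eq)))
      (subst (InN G (to s′)) (strictlyInverseˡ y) (N⇒InN s′y))

  private-to : ∀ {S s t} → Private (Members S) s t → PrivNbr G S (to s) (to t)
  private-to {S} {t = t} (st , excl) = N⇒InN st , λ u u∈S u≢ uy →
    excl (from u) (subst (_∈ S) (sym (strictlyInverseˡ u)) u∈S)
      (λ eq → u≢ (trans (sym (strictlyInverseˡ u)) (cong to eq)))
      (subst N[ from u ] (strictlyInverseʳ t) (InN⇒N uy))

  irredundant-from : ∀ {S} → D.Irredundant G S → Irredundant (Members S)
  irredundant-from {S} irr s s∈S with irr (to s) s∈S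
  ... | y , priv =
    from y , subst (λ v → Private (Members S) v (from y)) (strictlyInverseʳ s) (private-from priv)

  irredundant-to : ∀ {S} → Irredundant (Members S) → D.Irredundant G S
  irredundant-to {S} irr x x∈S with irr (from x) (subst (_∈ S) (sym (strictlyInverseˡ x)) x∈S)
  ... | t , priv =
    to t , subst (λ u → PrivNbr G S u (to t)) (strictlyInverseˡ x) (private-to priv)

  members-insert⁺ : ∀ {S x} → Members S ∪₁ ｛ from x ｝ ⊆ Members (S ∪ ⁅ x ⁆)
  members-insert⁺ (inj₁ s∈S) = x∈p∪q⁺ (inj₁ s∈S)
  members-insert⁺ {x = x} (inj₂ refl) =
    x∈p∪q⁺ (inj₂ (subst (_∈ ⁅ x ⁆) (sym (strictlyInverseˡ x)) (x∈⁅x⁆ x)))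

  members-insert⁻ : ∀ {S w} → Members (S ∪ ⁅ to w ⁆) ⊆ Members S ∪₁ ｛ w ｝
  members-insert⁻ {S} {w} s∈ =
    map₂ (λ s∈⁅w⁆ → sym (to-injective (x∈⁅y⁆⇒x≡y (to w) s∈⁅w⁆))) (x∈p∪q⁻ S ⁅ to w ⁆ s∈)

  maximal-from : ∀ {S} → D.MaximalIrredundant G S → MaximalIrredundant (Members S)
  maximal-from (irr , max) = irredundant-from irr , λ w w∉S irr′ →
    max (to w) w∉S (irredundant-to (irredundant-⊆ members-insert⁻ irr′))

  maximal-to : ∀ {S} → MaximalIrredundant (Members S) → D.MaximalIrredundant G S
  maximal-to {S} (irr , max) = irredundant-to irr , λ x x∉S irr′ →
    max (from x) (x∉S ∘ subst (_∈ S) (strictlyInverseˡ x))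
      (irredundant-⊆ members-insert⁺ (irredundant-from irr′))

  proper-from : ∀ {c col} → ProperColoring G c col → Proper (col ∘ to)
  proper-from proper e = proper _ _ (adj e)

  proper-to : ∀ {c} {col : V → Fin c} → Proper col → ProperColoring G c (col ∘ from)
  proper-to proper _ _ = proper

  rainbow-from : ∀ {c S} {col : Fin n → Fin c} →
                 (∀ u v → u ∈ S → v ∈ S → col u ≡ col v → u ≡ v) →
                 RainbowOn (Members S) (col ∘ to)
  rainbow-from rainbow s∈S t∈S eq = to-injective (rainbow _ _ s∈S t∈S eq)

  rainbow-to : ∀ {c S} {col : V → Fin c} → RainbowOn (Members S) col →
               ∀ u v → u ∈ S → v ∈ S → col (from u) ≡ col (from v) → u ≡ v
  rainbow-to {S = S} rainbow u v u∈S v∈S eq = from-injective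
    (rainbow (subst (_∈ S) (sym (strictlyInverseˡ u)) u∈S)
             (subst (_∈ S) (sym (strictlyInverseˡ v)) v∈S) eq)

module Construction (a′ l′ : ℕ) where

  a : ℕ
  a = suc (suc a′)

  l : ℕ
  l = suc l′

  data V : Set where
    q : Fin a → V
    r : Fin l → V
    b : Fin l → Fin a → V
    p : Fin l → V

  data E : Rel V 0ℓ where
    q-q : ∀ {i i′} → i ≢ i′ → E (q i) (q i′)
    q-r : ∀ {i j} → E (q i) (r j)
    r-q : ∀ {i j} → E (r j) (q i)
    q-b : ∀ {i j} → E (q i) (b j i)
    b-q : ∀ {i j} → E (b j i) (q i)
    r-b : ∀ {i j} → E (r j) (b j i)
    b-r : ∀ {i j} → E (b j i) (r j)
    r-p : ∀ {j} → E (r j) (p j)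
    p-r : ∀ {j} → E (p j) (r j)

  E? : Decidable E
  E? (q i) (q i′) = map′ q-q (λ { (q-q i≢i′) → i≢i′ }) (¬? (i ≟ᶠ i′))
  E? (q _) (r _) = yes q-r
  E? (q i) (b _ i′) = map′ (λ { refl → q-b }) (λ { q-b → refl }) (i ≟ᶠ i′)
  E? (q _) (p _) = no λ ()
  E? (r _) (q _) = yes r-q
  E? (r _) (r _) = no λ ()
  E? (r j) (b j′ _) = map′ (λ { refl → r-b }) (λ { r-b → refl }) (j ≟ᶠ j′)
  E? (r j) (p j′) = map′ (λ { refl → r-p }) (λ { r-p → refl }) (j ≟ᶠ j′)
  E? (b _ i) (q i′) = map′ (λ { refl → b-q }) (λ { b-q → refl }) (i ≟ᶠ i′)
  E? (b j _) (r j′) = map′ (λ { refl → b-r }) (λ { b-r → refl }) (j ≟ᶠ j′)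
  E? (b _ _) (b _ _) = no λ ()
  E? (b _ _) (p _) = no λ ()
  E? (p _) (q _) = no λ ()
  E? (p j) (r j′) = map′ (λ { refl → p-r }) (λ { p-r → refl }) (j ≟ᶠ j′)
  E? (p _) (b _ _) = no λ ()
  E? (p _) (p _) = no λ ()

  E-sym : Symmetric E
  E-sym (q-q i≢i′) = q-q (i≢i′ ∘ sym)
  E-sym q-r = r-q
  E-sym r-q = q-r
  E-sym q-b = b-q
  E-sym b-q = q-b
  E-sym r-b = b-r
  E-sym b-r = r-b
  E-sym r-p = p-r
  E-sym p-r = r-p

  E-irrefl : ∀ {v} → ¬ E v v
  E-irrefl (q-q i≢i) = i≢i refl

  to-q₀ : ∀ v → Star E v (q zero)
  to-q₀ (q zero) = ε
  to-q₀ (q (suc i)) = q-q (λ ()) ◅ ε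
  to-q₀ (r _) = r-q ◅ ε
  to-q₀ (b _ _) = b-r ◅ r-q ◅ ε
  to-q₀ (p _) = p-r ◅ r-q ◅ ε

  n : ℕ
  n = l + (l + (a + l * a))

  -- The centres r j come first, so that {r j} is the initial segment ⊤ˢ ++ ⊥ˢ of Fin n.
  ι : V ↔ Fin n
  ι = ↔-trans V↔parts (↔-sym (↔-trans +↔⊎ (↔-refl ⊎-cong
        (↔-trans +↔⊎ (↔-refl ⊎-cong (↔-trans +↔⊎ (↔-refl ⊎-cong *↔×)))))))
    where
    Parts : Set
    Parts = Fin l ⊎ (Fin l ⊎ (Fin a ⊎ (Fin l × Fin a)))

    split : V → Parts
    split (r j) = inj₁ j
    split (p j) = inj₂ (inj₁ j)
    split (q i) = inj₂ (inj₂ (inj₁ i))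
    split (b j i) = inj₂ (inj₂ (inj₂ (j , i)))

    glue : Parts → V
    glue (inj₁ j) = r j
    glue (inj₂ (inj₁ j)) = p j
    glue (inj₂ (inj₂ (inj₁ i))) = q i
    glue (inj₂ (inj₂ (inj₂ (j , i)))) = b j i

    split-glue : ∀ x → split (glue x) ≡ x
    split-glue (inj₁ _) = refl
    split-glue (inj₂ (inj₁ _)) = refl
    split-glue (inj₂ (inj₂ (inj₁ _))) = refl
    split-glue (inj₂ (inj₂ (inj₂ _))) = refl

    glue-split : ∀ v → glue (split v) ≡ v
    glue-split (r _) = refl
    glue-split (p _) = refl
    glue-split (q _) = refl
    glue-split (b _ _) = refl

    V↔parts : V ↔ Parts
    V↔parts = mk↔ₛ′ split glue split-glue glue-split

  open Encoded ι E E? E-sym E-irrefl (q zero) to-q₀ public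
  open Inverse ι using (to; from)

  N[p]⊆N[r] : ∀ {j} → N[ p j ] ⊆ N[ r j ]
  N[p]⊆N[r] (inj₁ refl) = inj₂ r-p
  N[p]⊆N[r] (inj₂ p-r) = inj₁ refl

  N[b]⊆N[r] : ∀ {j i} → N[ b j i ] ⊆ N[ r j ]
  N[b]⊆N[r] (inj₁ refl) = inj₂ r-b
  N[b]⊆N[r] (inj₂ b-q) = inj₂ r-q
  N[b]⊆N[r] (inj₂ b-r) = inj₁ refl

  N[b]⊆N[q] : ∀ {j i} → N[ b j i ] ⊆ N[ q i ]
  N[b]⊆N[q] (inj₁ refl) = inj₂ q-b
  N[b]⊆N[q] (inj₂ b-q) = inj₁ refl
  N[b]⊆N[q] (inj₂ b-r) = inj₂ q-r

  module _ {R : Pred V 0ℓ} {j : Fin l} where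

    p-undominated : ¬ R (p j) → ¬ R (r j) → ∀ s → R s → ¬ N[ s ] (p j)
    p-undominated p∉R _ _ s∈R (inj₁ refl) = p∉R s∈R
    p-undominated _ r∉R _ s∈R (inj₂ r-p) = r∉R s∈R

    b-undominated : ∀ {i} → ¬ R (b j i) → ¬ R (q i) → ¬ R (r j) →
                    ∀ s → R s → ¬ N[ s ] (b j i)
    b-undominated b∉R _ _ _ s∈R (inj₁ refl) = b∉R s∈R
    b-undominated _ q∉R _ _ s∈R (inj₂ q-b) = q∉R s∈R
    b-undominated _ _ r∉R _ s∈R (inj₂ r-b) = r∉R s∈R

    p-private-self : ¬ R (r j) → Private R (p j) (p j)
    p-private-self r∉R = private-intro (inj₁ refl) λ
      { _ _ (inj₁ refl) → refl
      ; _ s∈R (inj₂ r-p) → ⊥-elim (r∉R s∈R) }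

    r-private-p : ¬ R (p j) → Private R (r j) (p j)
    r-private-p p∉R = private-intro (inj₂ r-p) λ
      { _ s∈R (inj₁ refl) → ⊥-elim (p∉R s∈R)
      ; _ _ (inj₂ r-p) → refl }

    q-private-b : ∀ {i} → ¬ R (b j i) → ¬ R (r j) → Private R (q i) (b j i)
    q-private-b b∉R r∉R = private-intro (inj₂ q-b) λ
      { _ s∈R (inj₁ refl) → ⊥-elim (b∉R s∈R)
      ; _ _ (inj₂ q-b) → refl
      ; _ s∈R (inj₂ r-b) → ⊥-elim (r∉R s∈R) }

    b-private-self : ∀ {i} → ¬ R (q i) → ¬ R (r j) → Private R (b j i) (b j i)
    b-private-self q∉R r∉R = private-intro (inj₁ refl) λ
      { _ _ (inj₁ refl) → refl
      ; _ s∈R (inj₂ q-b) → ⊥-elim (q∉R s∈R)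
      ; _ s∈R (inj₂ r-b) → ⊥-elim (r∉R s∈R) }

  slot : V → Fin a ⊎ Fin l
  slot (q i) = inj₁ i
  slot (b _ i) = inj₁ i
  slot (r j) = inj₂ j
  slot (p j) = inj₂ j

  clique-centres-apart : ∀ {R} → (∀ j → R (r j)) →
                         ∀ x y → x ≡ y ⊎ Apart R ([ q , r ]′ x) ([ q , r ]′ y)
  clique-centres-apart _ (inj₁ i) (inj₁ i′) with i ≟ᶠ i′
  ... | yes refl = inj₁ refl
  ... | no i≢i′ = inj₂ (inj₁ (q-q i≢i′))
  clique-centres-apart _ (inj₁ _) (inj₂ _) = inj₂ (inj₁ q-r)
  clique-centres-apart _ (inj₂ _) (inj₁ _) = inj₂ (inj₁ r-q)
  clique-centres-apart centres∈R (inj₂ j) (inj₂ j′) with j ≟ᶠ j′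
  ... | yes refl = inj₁ refl
  ... | no j≢j′ = inj₂ (inj₂ (centres∈R j , centres∈R j′ , λ { refl → j≢j′ refl }))

  module Maximal {R : Pred V 0ℓ} (R? : Decidable₁ R) (maximal : MaximalIrredundant R) where

    irr : Irredundant R
    irr = proj₁ maximal

    max : ∀ w → ¬ R w → ¬ Irredundant (R ∪₁ ｛ w ｝)
    max = proj₂ maximal

    -- A private neighbour lost to p j is r j; it is replaced by b j i (for s = q i) or by s itself.
    pendant-forced : ∀ j → ¬ R (r j) → R (p j)
    pendant-forced j r∉R = decidable-stable (R? (p j)) λ p∉R →
      max (p j) p∉R
        (insert-irredundant irr (p j , inj₁ refl , p-undominated {R = R} p∉R r∉R) (reroute p∉R))
      where
      reroute : ¬ R (p j) → ∀ {s t} → R s → Private R s t → N[ p j ] t →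
                ∃ λ t′ → Private R s t′ × ¬ N[ p j ] t′
      reroute p∉R s∈R (st , _) (inj₁ refl) = ⊥-elim (p-undominated {R = R} p∉R r∉R _ s∈R st)
      reroute _ s∈R (inj₁ refl , _) (inj₂ p-r) = ⊥-elim (r∉R s∈R)
      reroute p∉R s∈R (inj₂ p-r , _) (inj₂ p-r) = ⊥-elim (p∉R s∈R)
      reroute _ {q i} s∈R (inj₂ q-r , _) (inj₂ p-r) with R? (b j i)
      ... | yes b∈R = ⊥-elim (nested⇒redundant irr b∈R s∈R (λ ()) N[b]⊆N[q])
      ... | no b∉R = b j i , q-private-b b∉R r∉R , λ { (inj₁ ()) ; (inj₂ ()) }
      reroute _ {b j i} s∈R priv@(inj₂ b-r , _) (inj₂ p-r) =
        b j i , b-private-self (λ q∈R → q≢b (private-unique priv q∈R (inj₂ q-r))) r∉R ,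
        λ { (inj₁ ()) ; (inj₂ ()) }
        where
        q≢b : q i ≢ b j i
        q≢b ()

    -- A private neighbour lost to b j i is either r j, whose owner must be p j ∈ R, or q i,
    -- replaced by b j i′, p j′ or s itself according to the shape of s.
    bridge-forced : ∀ j i → ¬ R (r j) → ¬ R (q i) → R (b j i)
    bridge-forced j i r∉R q∉R = decidable-stable (R? (b j i)) λ b∉R →
      max (b j i) b∉R
        (insert-irredundant irr (b j i , inj₁ refl , b-undominated {R = R} b∉R q∉R r∉R)
          (reroute b∉R))
      where
      reroute : ¬ R (b j i) → ∀ {s t} → R s → Private R s t → N[ b j i ] t →
                ∃ λ t′ → Private R s t′ × ¬ N[ b j i ] t′
      reroute b∉R s∈R (st , _) (inj₁ refl) = ⊥-elim (b-undominated {R = R} b∉R q∉R r∉R _ s∈R st)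
      reroute _ s∈R priv (inj₂ b-r) with private-unique priv (pendant-forced j r∉R) (inj₂ p-r)
      ... | refl = p j , p-private-self r∉R , λ { (inj₁ ()) ; (inj₂ ()) }
      reroute _ s∈R (inj₁ refl , _) (inj₂ b-q) = ⊥-elim (q∉R s∈R)
      reroute _ {q i′} s∈R (inj₂ (q-q i′≢i) , _) (inj₂ b-q) with R? (b j i′)
      ... | yes b′∈R = ⊥-elim (nested⇒redundant irr b′∈R s∈R (λ ()) N[b]⊆N[q])
      ... | no b′∉R = b j i′ , q-private-b b′∉R r∉R , λ { (inj₁ refl) → i′≢i refl ; (inj₂ ()) }
      reroute _ {r j′} s∈R (inj₂ r-q , _) (inj₂ b-q) with R? (p j′)
      ... | yes p′∈R = ⊥-elim (nested⇒redundant irr p′∈R s∈R (λ ()) N[p]⊆N[r])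
      ... | no p′∉R = p j′ , r-private-p p′∉R , λ { (inj₁ ()) ; (inj₂ ()) }
      reroute b∉R {b j′ i} s∈R (inj₂ b-q , _) (inj₂ b-q) with R? (r j′)
      ... | yes r′∈R = ⊥-elim (nested⇒redundant irr s∈R r′∈R (λ ()) N[b]⊆N[r])
      ... | no r′∉R = b j′ i , b-private-self q∉R r′∉R , λ { (inj₁ refl) → b∉R s∈R ; (inj₂ ()) }

    anchor : ∀ j → ∃ λ v → R v × slot v ≡ inj₂ j
    anchor j with R? (r j)
    ... | yes r∈R = r j , r∈R , refl
    ... | no r∉R = p j , pendant-forced j r∉R , refl

    rainbow-bound : ∀ {c} {col : V → Fin c} → Proper col → RainbowOn R col → a + l ≤ c
    rainbow-bound proper rainbow with all? (R? ∘ r)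
    ... | yes centres∈R =
      apart-family⇒≤ proper rainbow +↔⊎ [ q , r ]′ (clique-centres-apart {R} centres∈R)
    ... | no ¬centres∈R with ¬∀⟶∃¬ l (R ∘ r) (R? ∘ r) ¬centres∈R
    ...   | j₀ , r∉R = labelled-members⇒≤ rainbow +↔⊎ slot representative
      where
      representative : ∀ x → ∃ λ v → R v × slot v ≡ x
      representative (inj₁ i) with R? (q i)
      ... | yes q∈R = q i , q∈R , refl
      ... | no q∉R = b j₀ i , bridge-forced j₀ i r∉R q∉R , refl
      representative (inj₂ j) = anchor j

  other : Fin a → Fin a
  other zero = suc zero
  other (suc _) = zero

  other-≢ : ∀ i → other i ≢ i
  other-≢ zero ()
  other-≢ (suc _) ()

  colouring : ∀ {c} → (Fin a → Fin c) → (Fin l → Fin c) → V → Fin c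
  colouring κ ρ (q i) = κ i
  colouring κ ρ (r j) = ρ j
  colouring κ ρ (b _ i) = κ (other i)
  colouring κ ρ (p _) = κ zero

  colouring-proper : ∀ {c} {κ : Fin a → Fin c} {ρ : Fin l → Fin c} →
                     Injective _≡_ _≡_ κ → (∀ i j → κ i ≢ ρ j) → Proper (colouring κ ρ)
  colouring-proper κ-inj _ (q-q i≢i′) = i≢i′ ∘ κ-inj
  colouring-proper _ κ≢ρ q-r = κ≢ρ _ _
  colouring-proper _ κ≢ρ r-q = κ≢ρ _ _ ∘ sym
  colouring-proper κ-inj _ q-b = other-≢ _ ∘ sym ∘ κ-inj
  colouring-proper κ-inj _ b-q = other-≢ _ ∘ κ-inj
  colouring-proper _ κ≢ρ r-b = κ≢ρ _ _ ∘ sym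
  colouring-proper _ κ≢ρ b-r = κ≢ρ _ _
  colouring-proper _ κ≢ρ r-p = κ≢ρ _ _ ∘ sym
  colouring-proper _ κ≢ρ p-r = κ≢ρ _ _

  clique : Fin (suc a) → V
  clique zero = r zero
  clique (suc i) = q i

  clique-apart : ∀ x y → x ≡ y ⊎ Apart ∅ (clique x) (clique y)
  clique-apart zero zero = inj₁ refl
  clique-apart zero (suc _) = inj₂ (inj₁ r-q)
  clique-apart (suc _) zero = inj₂ (inj₁ q-r)
  clique-apart (suc i) (suc i′) with i ≟ᶠ i′
  ... | yes refl = inj₁ refl
  ... | no i≢i′ = inj₂ (inj₁ (q-q i≢i′))

  I : Subset n
  I = ⊤ˢ {l} ++ ⊥ˢ

  centre∈I : ∀ j → Members I (r j)
  centre∈I j = ↑ˡ∈⊤ˢ++ j ⊥ˢ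

  I-centre : ∀ {s} → Members I s → ∃ λ j → s ≡ r j
  I-centre {r j} _ = j , refl
  I-centre {q _} s∈I = ⊥-elim (↑ʳ∉⊤ˢ++⊥ˢ l _ s∈I)
  I-centre {b _ _} s∈I = ⊥-elim (↑ʳ∉⊤ˢ++⊥ˢ l _ s∈I)
  I-centre {p _} s∈I = ⊥-elim (↑ʳ∉⊤ˢ++⊥ˢ l _ s∈I)

  ∣I∣≡l : ∣ I ∣ ≡ l
  ∣I∣≡l = trans (∣⊤ˢ++p∣≡m+∣p∣ l ⊥ˢ)
                (trans (cong (l +_) (∣⊥∣≡0 (l + (a + l * a)))) (+-identityʳ l))

  centre : V → Fin l
  centre (q _) = zero
  centre (r j) = j
  centre (b j _) = j
  centre (p j) = j

  centre-dominates : ∀ t → N[ r (centre t) ] t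
  centre-dominates (q _) = inj₂ r-q
  centre-dominates (r _) = inj₁ refl
  centre-dominates (b _ _) = inj₂ r-b
  centre-dominates (p _) = inj₂ r-p

  I-maximal : MaximalIrredundant (Members I)
  I-maximal = irredundant-dominating⇒maximal I-irredundant
    λ t → r (centre t) , centre∈I _ , centre-dominates t
    where
    p≢r : ∀ {j j′} → p j ≢ r j′
    p≢r ()

    I-irredundant : Irredundant (Members I)
    I-irredundant s s∈I with I-centre {s} s∈I
    ... | j , refl = p j , r-private-p (p≢r ∘ proj₂ ∘ I-centre)

  chromatic-number : ChromaticNumberIs G (suc a)
  chromatic-number =
    (colouring suc (λ _ → zero) ∘ from , proper-to (colouring-proper suc-injective λ _ _ ())) ,
    λ c col proper → apart-family⇒≤ {R = ∅} (proper-from proper) (λ ()) ↔-refl clique clique-apart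

  lower-irredundance : LowerIrredundanceIs G l
  lower-irredundance = (I , maximal-to I-maximal , ∣I∣≡l) , bound
    where
    bound : ∀ S → D.MaximalIrredundant G S → l ≤ ∣ S ∣
    bound S max = injective-into⇒≤∣∣ S
      (labelled-injective slot inj₂-injective anchor ∘ to-injective) (proj₁ ∘ proj₂ ∘ anchor)
      where open Maximal (members? S) (maximal-from max)

  irredundance-chromatic-number : IrredundanceChromaticNumberIs G (a + l)
  irredundance-chromatic-number =
    (colouring (_↑ˡ l) (a ↑ʳ_) ∘ from ,
     proper-to proper , I , maximal-to I-maximal , rainbow-to rainbow) ,
    λ { c col (proper′ , S , max , rainbow′) →
          Maximal.rainbow-bound (members? S) (maximal-from max)
            (proper-from proper′) (rainbow-from rainbow′) }
    where
    proper : Proper (colouring (_↑ˡ l) (a ↑ʳ_))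
    proper = colouring-proper (↑ˡ-injective l _ _) ↑ˡ≢↑ʳ
    rainbow : RainbowOn (Members I) (colouring (_↑ˡ l) (a ↑ʳ_))
    rainbow {s} {t} s∈I t∈I eq with I-centre {s} s∈I | I-centre {t} t∈I
    ... | j , refl | j′ , refl = cong r (↑ʳ-injective a j j′ eq)

theorem2 : ∀ (k l : ℕ) → 3 ≤ k → 1 ≤ l →
    ∃ λ (G : Graph) → ChromaticNumberIs G k × LowerIrredundanceIs G l
      × IrredundanceChromaticNumberIs G (k + l ∸ 1)
theorem2 (suc (suc (suc a′))) (suc l′) (s≤s (s≤s (s≤s _))) (s≤s _) =
  G , chromatic-number , lower-irredundance , irredundance-chromatic-number
  where open Construction a′ l′
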